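{- For every integer $n\ge 0$, \[ \overline{p}_o(n)=\sum_{k=-\infty}^{\infty}(-1)^k\,\overline{p}(n-2k^2). \]
   Context: An overpartition of $n$ is a partition of $n$ in which the first occurrence of each part size may be overlined. $\overline{p}(n)$ is the number of overpartitions of $n$, with $\sum_{n\ge0}\overline{p}(n)q^n=\frac{(-q;q)_\infty}{(q;q)_\infty}$; $\overline{p}_o(n)$ is the number of overpartitions of $n$ into odd parts, with $\sum_{n\ge0}\overline{p}_o(n)q^n=\frac{(-q;q^2)_\infty}{(q;q^2)_\infty}$, where $(a;q)_\infty=\prod_{k\ge1}(1-aq^{k-1})$. Convention: $\overline{p}(x)=0$ whenever $x$ is not a nonnegative integer. -}

module Defs where

open import Data.Bool using (Bool; true; false; if_then_else_)
open import Data.Nat as ℕ using (ℕ; zero; suc; _∸_)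
open import Data.Nat.Divisibility using (_∣?_)
open import Data.Nat.Properties using (_≟_)
open import Data.Integer as ℤ using (ℤ; +_; -[1+_]; 0ℤ; 1ℤ; -1ℤ; _+_; _*_; _-_; ∣_∣)
open import Data.List using (List; []; _∷_; map; upTo)
open import Relation.Nullary.Decidable using (⌊_⌋)

-- Formal power series in q with integer coefficients: n ↦ [q^n].
PS : Set
PS = ℕ → ℤ

sumTo : (ℕ → ℤ) → ℕ → ℤ
sumTo f zero    = f zero
sumTo f (suc n) = sumTo f n + f (suc n)

_⊛_ : PS → PS → PS
(f ⊛ g) n = sumTo (λ i → f i * g (n ∸ i)) n

one : PS
one zero    = 1ℤ
one (suc _) = 0ℤ

-- the polynomial 1 + q^k   (used for k ≥ 1)
onePlusQ : ℕ → PS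
onePlusQ k n = if ⌊ n ≟ 0 ⌋ then 1ℤ else (if ⌊ n ≟ k ⌋ then 1ℤ else 0ℤ)

-- 1 / (1 - q^k) = Σ_{j≥0} q^{jk}   (used for k ≥ 1)
geomQ : ℕ → PS
geomQ k n = if ⌊ k ∣? n ⌋ then 1ℤ else 0ℤ

factor : ℕ → PS
factor k = onePlusQ k ⊛ geomQ k

prodFactors : (ℕ → Bool) → ℕ → PS
prodFactors sel zero    = one
prodFactors sel (suc N) =
  if sel (suc N) then prodFactors sel N ⊛ factor (suc N) else prodFactors sel N

isOdd : ℕ → Bool
isOdd zero          = false
isOdd (suc zero)    = true
isOdd (suc (suc k)) = isOdd k

-- The coefficient of q^n in an infinite product ∏_{k≥1} (1+q^k)/(1-q^k)
-- only depends on the factors with k ≤ n (the others are 1 + O(q^{n+1})).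

-- overpartitions: Σ pbar(n) q^n = (-q;q)_∞ / (q;q)_∞ = ∏_{k≥1} (1+q^k)/(1-q^k)
pbar : ℕ → ℤ
pbar n = prodFactors (λ _ → true) n n

-- overpartitions into odd parts:
-- Σ pbaro(n) q^n = (-q;q²)_∞ / (q;q²)_∞ = ∏_{k≥1, k odd} (1+q^k)/(1-q^k)
pbaro : ℕ → ℤ
pbaro n = prodFactors isOdd n n

-- convention: pbar(x) = 0 when x is negative
pbarℤ : ℤ → ℤ
pbarℤ (+ n)    = pbar n
pbarℤ -[1+ n ] = 0ℤ

sumℤ : List ℤ → ℤ
sumℤ []       = 0ℤ
sumℤ (x ∷ xs) = x + sumℤ xs

-- Σ_{k=-M}^{M} f k
symSum : ℕ → (ℤ → ℤ) → ℤ
symSum M f = sumℤ (map (λ i → f (+ i - + M)) (upTo (suc (2 ℕ.* M))))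

summand : ℕ → ℤ → ℤ
summand n k = (-1ℤ ℤ.^ ∣ k ∣) * pbarℤ (+ n - 2ℤ * (k * k))
  where 2ℤ = + 2

-- With θ(q) = Σ_k (−1)^k q^{k²}, the right-hand side has generating function
-- θ(q²) (−q; q)_∞ / (q; q)_∞.  The product splits into its odd part, the generating
-- function of p̄_o, and its even part (−q²; q²)_∞ / (q²; q²)_∞, which θ(q²) cancels by
-- Gauss's identity θ(q) (−q; q)_∞ = (q; q)_∞.  Gauss's identity comes from the finite form
--   Σ_{|k| ≤ n} (−1)^k q^{k²} / ((q; q)_{n+k} (q; q)_{n−k}) = 1 / (q²; q²)_n,
-- proved by induction on n: after multiplying by 1 − q^{2n} every term splits in two, and
-- the pieces either cancel in pairs under a reflection k ↦ c − k or add up to the sum for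
-- n − 1.  As 1 / (q; q)_{n−|k|} agrees with 1 / (q; q)_n up to degree n − |k| and k² ≥ |k|,
-- the finite form gives θ_n(q) / (q; q)_n² = 1 / (q²; q²)_n up to degree n, where θ_n is the
-- partial sum over |k| ≤ n; this is all of Gauss's identity that a coefficient of degree ≤ n sees.
module Submission where

open import Defs
open import Algebra.Bundles using (CommutativeRing)
import Algebra.Solver.Ring
open import Algebra.Solver.Ring.AlmostCommutativeRing using (fromCommutativeRing; _-Raw-AlmostCommutative⟶_)
open import Data.Bool using (Bool; true; false; not; if_then_else_)
open import Data.Empty using (⊥-elim)
open import Data.Integer as ℤ using (ℤ; +_; -[1+_]; 0ℤ; 1ℤ; -1ℤ; _+_; _*_; -_; _-_; ∣_∣)
import Data.Integer.Properties as ℤ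
open import Data.Integer.Tactic.RingSolver using (solve-∀)
open import Data.List using (map; applyUpTo)
open import Data.Maybe using (Maybe; just; nothing)
open import Data.Nat as ℕ using (ℕ; zero; suc; _∸_; _≤_; _<_; z≤n; s≤s)
open import Data.Nat.Divisibility using (_∣?_; ∣⇒≤; _∣0; ∣-refl; ∣m+n∣m⇒∣n; ∣m∣n⇒∣m+n)
import Data.Nat.Properties as ℕ
open import Data.Product using (_,_)
open import Function using (_∘_)
open import Level using (0ℓ)
open import Relation.Binary.Bundles using (Setoid)
open import Relation.Binary.PropositionalEquality
  using (_≡_; refl; sym; trans; cong; cong₂; subst; subst₂; module ≡-Reasoning)
import Relation.Binary.Reasoning.Setoid as SetoidReasoning
open import Relation.Nullary using (yes; no)
open import Relation.Nullary.Decidable using (⌊_⌋; isYes≗does)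

-- Finite sums

∑< : ℕ → (ℕ → ℤ) → ℤ
∑< zero    f = 0ℤ
∑< (suc n) f = f 0 + ∑< n (f ∘ suc)

syntax ∑< n (λ i → e) = ∑[ i < n ] e

∑-cong : ∀ n {f g : ℕ → ℤ} → (∀ i → i < n → f i ≡ g i) → ∑< n f ≡ ∑< n g
∑-cong zero    eq = refl
∑-cong (suc n) eq = cong₂ _+_ (eq 0 (s≤s z≤n)) (∑-cong n (λ i i<n → eq (suc i) (s≤s i<n)))

∑-distrib-+ : ∀ n (f g : ℕ → ℤ) → ∑[ i < n ] (f i + g i) ≡ ∑< n f + ∑< n g
∑-distrib-+ zero    f g = refl
∑-distrib-+ (suc n) f g =
  trans (cong (_+_ (f 0 + g 0)) (∑-distrib-+ n (f ∘ suc) (g ∘ suc))) (shuffle (f 0) (g 0) _ _)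
  where
  shuffle : ∀ a b c d → a + b + (c + d) ≡ a + c + (b + d)
  shuffle = solve-∀

∑-distribˡ-* : ∀ n c (f : ℕ → ℤ) → ∑[ i < n ] (c * f i) ≡ c * ∑< n f
∑-distribˡ-* zero    c f = sym (ℤ.*-zeroʳ c)
∑-distribˡ-* (suc n) c f =
  trans (cong (_+_ (c * f 0)) (∑-distribˡ-* n c (f ∘ suc))) (sym (ℤ.*-distribˡ-+ c (f 0) _))

∑-neg : ∀ n (f : ℕ → ℤ) → ∑[ i < n ] (- f i) ≡ - ∑< n f
∑-neg zero    f = refl
∑-neg (suc n) f = trans (cong (_+_ (- f 0)) (∑-neg n (f ∘ suc))) (sym (ℤ.neg-distrib-+ (f 0) _))

∑-zero : ∀ n → ∑[ i < n ] 0ℤ ≡ 0ℤ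
∑-zero zero    = refl
∑-zero (suc n) = trans (ℤ.+-identityˡ _) (∑-zero n)

∑-last : ∀ n (f : ℕ → ℤ) → ∑< (suc n) f ≡ ∑< n f + f n
∑-last zero    f = ℤ.+-comm (f 0) 0ℤ
∑-last (suc n) f = trans (cong (_+_ (f 0)) (∑-last n (f ∘ suc))) (sym (ℤ.+-assoc (f 0) _ _))

∑-reverse : ∀ n (f : ℕ → ℤ) → ∑< n f ≡ ∑[ i < n ] f (n ∸ suc i)
∑-reverse zero    f = refl
∑-reverse (suc n) f = begin
  f 0 + ∑< n (f ∘ suc)                          ≡⟨ cong (_+_ (f 0)) (∑-reverse n (f ∘ suc)) ⟩
  f 0 + ∑[ i < n ] f (suc (n ∸ suc i))          ≡⟨ ℤ.+-comm (f 0) _ ⟩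
  ∑[ i < n ] f (suc (n ∸ suc i)) + f 0          ≡⟨ cong₂ _+_ (∑-cong n (λ i i<n → cong f (sym (ℕ.+-∸-assoc 1 i<n))))
                                                              (cong f (sym (ℕ.n∸n≡0 n))) ⟩
  ∑[ i < n ] f (suc n ∸ suc i) + f (n ∸ n)      ≡⟨ sym (∑-last n _) ⟩
  ∑[ i < suc n ] f (suc n ∸ suc i)              ∎
  where open ≡-Reasoning

∑-comm : ∀ m n (g : ℕ → ℕ → ℤ) → ∑[ i < m ] ∑[ j < n ] g i j ≡ ∑[ j < n ] ∑[ i < m ] g i j
∑-comm zero    n g = sym (∑-zero n)
∑-comm (suc m) n g =
  trans (cong (_+_ (∑< n (g 0))) (∑-comm m n (g ∘ suc))) (sym (∑-distrib-+ n (g 0) _))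

∑-antisymmetric : ∀ n (f : ℕ → ℤ) → (∀ i j → suc (i ℕ.+ j) ≡ n → f i ≡ - f j) → ∑< n f ≡ 0ℤ
∑-antisymmetric n f anti = self-negation (begin
  ∑< n f                         ≡⟨ ∑-reverse n f ⟩
  ∑[ i < n ] f (n ∸ suc i)       ≡⟨ ∑-cong n (λ i i<n → anti _ i (complement i<n)) ⟩
  ∑[ i < n ] (- f i)             ≡⟨ ∑-neg n f ⟩
  - ∑< n f                       ∎)
  where
  open ≡-Reasoning
  complement : ∀ {i} → i < n → suc (n ∸ suc i ℕ.+ i) ≡ n
  complement (s≤s i<n) = cong suc (ℕ.m∸n+n≡m i<n)
  self-negation : ∀ {x} → x ≡ - x → x ≡ 0ℤ
  self-negation {+ zero} _ = refl

sumTo≡∑ : ∀ f n → sumTo f n ≡ ∑< (suc n) f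
sumTo≡∑ f zero    = sym (ℤ.+-identityʳ (f 0))
sumTo≡∑ f (suc n) = trans (cong (_+ f (suc n)) (sumTo≡∑ f n)) (sym (∑-last (suc n) f))

-- Formal power series

infix  4 _≈_
infixl 6 _⊕_
infixl 7 _·_
infix  8 ⊖_

_≈_ : PS → PS → Set
f ≈ g = ∀ t → f t ≡ g t

_⊕_ : PS → PS → PS
(f ⊕ g) t = f t + g t

⊖_ : PS → PS
(⊖ f) t = - f t

0ₛ : PS
0ₛ _ = 0ℤ

_·_ : ℤ → PS → PS
(c · f) t = c * f t

tail : PS → PS
tail f t = f (suc t)

shift : PS → PS
shift f zero    = 0ℤ
shift f (suc t) = f t

⊛-coeff : ∀ f g t → (f ⊛ g) t ≡ ∑[ i < suc t ] (f i * g (t ∸ i))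
⊛-coeff f g t = sumTo≡∑ _ t

⊛-suc : ∀ f g t → (f ⊛ g) (suc t) ≡ f 0 * g (suc t) + (tail f ⊛ g) t
⊛-suc f g t = trans (⊛-coeff f g (suc t)) (cong (_+_ (f 0 * g (suc t))) (sym (⊛-coeff (tail f) g t)))

⊛-cong : ∀ {f f′ g g′} → f ≈ f′ → g ≈ g′ → f ⊛ g ≈ f′ ⊛ g′
⊛-cong {f} {f′} {g} {g′} f≈f′ g≈g′ t = begin
  (f ⊛ g) t                            ≡⟨ ⊛-coeff f g t ⟩
  ∑[ i < suc t ] (f i * g (t ∸ i))     ≡⟨ ∑-cong (suc t) (λ i _ → cong₂ _*_ (f≈f′ i) (g≈g′ (t ∸ i))) ⟩
  ∑[ i < suc t ] (f′ i * g′ (t ∸ i))   ≡⟨ sym (⊛-coeff f′ g′ t) ⟩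
  (f′ ⊛ g′) t                          ∎
  where open ≡-Reasoning

⊛-distribʳ-⊕ : ∀ f g h → (f ⊕ g) ⊛ h ≈ f ⊛ h ⊕ g ⊛ h
⊛-distribʳ-⊕ f g h t = begin
  ((f ⊕ g) ⊛ h) t                                       ≡⟨ ⊛-coeff (f ⊕ g) h t ⟩
  ∑[ i < suc t ] ((f i + g i) * h (t ∸ i))              ≡⟨ ∑-cong (suc t) (λ i _ → ℤ.*-distribʳ-+ (h (t ∸ i)) (f i) (g i)) ⟩
  ∑[ i < suc t ] (f i * h (t ∸ i) + g i * h (t ∸ i))    ≡⟨ ∑-distrib-+ (suc t) (λ i → f i * h (t ∸ i)) (λ i → g i * h (t ∸ i)) ⟩
  ∑[ i < suc t ] (f i * h (t ∸ i)) + ∑[ i < suc t ] (g i * h (t ∸ i))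
                                                        ≡⟨ sym (cong₂ _+_ (⊛-coeff f h t) (⊛-coeff g h t)) ⟩
  (f ⊛ h ⊕ g ⊛ h) t                                     ∎
  where open ≡-Reasoning

·-⊛ : ∀ c f g → (c · f) ⊛ g ≈ c · (f ⊛ g)
·-⊛ c f g t = begin
  ((c · f) ⊛ g) t                         ≡⟨ ⊛-coeff (c · f) g t ⟩
  ∑[ i < suc t ] (c * f i * g (t ∸ i))    ≡⟨ ∑-cong (suc t) (λ i _ → ℤ.*-assoc c (f i) (g (t ∸ i))) ⟩
  ∑[ i < suc t ] (c * (f i * g (t ∸ i)))  ≡⟨ ∑-distribˡ-* (suc t) c (λ i → f i * g (t ∸ i)) ⟩
  c * ∑[ i < suc t ] (f i * g (t ∸ i))    ≡⟨ cong (c *_) (sym (⊛-coeff f g t)) ⟩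
  (c · (f ⊛ g)) t                         ∎
  where open ≡-Reasoning

⊛-assoc : ∀ f g h → (f ⊛ g) ⊛ h ≈ f ⊛ (g ⊛ h)
⊛-assoc f g h zero    = ℤ.*-assoc (f 0) (g 0) (h 0)
⊛-assoc f g h (suc t) = begin
  ((f ⊛ g) ⊛ h) (suc t)
    ≡⟨ ⊛-suc (f ⊛ g) h t ⟩
  f 0 * g 0 * h (suc t) + (tail (f ⊛ g) ⊛ h) t
    ≡⟨ cong (_+_ (f 0 * g 0 * h (suc t))) (⊛-cong {g = h} {g′ = h} (⊛-suc f g) (λ _ → refl) t) ⟩
  f 0 * g 0 * h (suc t) + ((f 0 · tail g ⊕ tail f ⊛ g) ⊛ h) t
    ≡⟨ cong (_+_ (f 0 * g 0 * h (suc t))) (⊛-distribʳ-⊕ (f 0 · tail g) (tail f ⊛ g) h t) ⟩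
  f 0 * g 0 * h (suc t) + (((f 0 · tail g) ⊛ h) t + ((tail f ⊛ g) ⊛ h) t)
    ≡⟨ cong (_+_ (f 0 * g 0 * h (suc t))) (cong₂ _+_ (·-⊛ (f 0) (tail g) h t) (⊛-assoc (tail f) g h t)) ⟩
  f 0 * g 0 * h (suc t) + (f 0 * (tail g ⊛ h) t + (tail f ⊛ (g ⊛ h)) t)
    ≡⟨ regroup (f 0) (g 0) (h (suc t)) _ _ ⟩
  f 0 * (g 0 * h (suc t) + (tail g ⊛ h) t) + (tail f ⊛ (g ⊛ h)) t
    ≡⟨ cong (λ z → f 0 * z + (tail f ⊛ (g ⊛ h)) t) (sym (⊛-suc g h t)) ⟩
  f 0 * (g ⊛ h) (suc t) + (tail f ⊛ (g ⊛ h)) t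
    ≡⟨ sym (⊛-suc f (g ⊛ h) t) ⟩
  (f ⊛ (g ⊛ h)) (suc t) ∎
  where
  open ≡-Reasoning
  regroup : ∀ a b c d e → a * b * c + (a * d + e) ≡ a * (b * c + d) + e
  regroup = solve-∀

⊛-comm : ∀ f g → f ⊛ g ≈ g ⊛ f
⊛-comm f g t = begin
  (f ⊛ g) t                                       ≡⟨ ⊛-coeff f g t ⟩
  ∑[ i < suc t ] (f i * g (t ∸ i))                ≡⟨ ∑-reverse (suc t) (λ i → f i * g (t ∸ i)) ⟩
  ∑[ i < suc t ] (f (t ∸ i) * g (t ∸ (t ∸ i)))    ≡⟨ ∑-cong (suc t) (λ i i≤t → trans
                                                       (cong (λ j → f (t ∸ i) * g j) (ℕ.m∸[m∸n]≡n (ℕ.≤-pred i≤t)))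
                                                       (ℤ.*-comm (f (t ∸ i)) (g i))) ⟩
  ∑[ i < suc t ] (g i * f (t ∸ i))                ≡⟨ sym (⊛-coeff g f t) ⟩
  (g ⊛ f) t                                       ∎
  where open ≡-Reasoning

⊛-identityˡ : ∀ f → one ⊛ f ≈ f
⊛-identityˡ f zero    = ℤ.*-identityˡ (f 0)
⊛-identityˡ f (suc t) = begin
  (one ⊛ f) (suc t)                      ≡⟨ ⊛-suc one f t ⟩
  1ℤ * f (suc t) + (tail one ⊛ f) t      ≡⟨ cong₂ _+_ (ℤ.*-identityˡ (f (suc t))) (⊛-coeff (tail one) f t) ⟩
  f (suc t) + ∑[ i < suc t ] (0ℤ * f (t ∸ i))  ≡⟨ cong (_+_ (f (suc t))) (trans (∑-distribˡ-* (suc t) 0ℤ (λ i → f (t ∸ i))) (ℤ.*-zeroˡ (∑[ i < suc t ] f (t ∸ i)))) ⟩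
  f (suc t) + 0ℤ                         ≡⟨ ℤ.+-identityʳ _ ⟩
  f (suc t)                              ∎
  where open ≡-Reasoning

shift-⊛ : ∀ f g → shift f ⊛ g ≈ shift (f ⊛ g)
shift-⊛ f g zero    = refl
shift-⊛ f g (suc t) =
  trans (⊛-suc (shift f) g t) (trans (cong (_+ (f ⊛ g) t) (ℤ.*-zeroˡ (g (suc t)))) (ℤ.+-identityˡ _))

PS-ring : CommutativeRing 0ℓ 0ℓ
PS-ring = record
  { Carrier = PS ; _≈_ = _≈_ ; _+_ = _⊕_ ; _*_ = _⊛_ ; -_ = ⊖_ ; 0# = 0ₛ ; 1# = one
  ; isCommutativeRing = record
    { isRing = record
      { +-isAbelianGroup = record
        { isGroup = record
          { isMonoid = record
            { isSemigroup = record
              { isMagma = record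
                { isEquivalence = record
                  { refl = λ _ → refl ; sym = λ p t → sym (p t) ; trans = λ p q t → trans (p t) (q t) }
                ; ∙-cong = λ p q t → cong₂ _+_ (p t) (q t) }
              ; assoc = λ f g h t → ℤ.+-assoc (f t) (g t) (h t) }
            ; identity = (λ f t → ℤ.+-identityˡ (f t)) , (λ f t → ℤ.+-identityʳ (f t)) }
          ; inverse = (λ f t → ℤ.+-inverseˡ (f t)) , (λ f t → ℤ.+-inverseʳ (f t))
          ; ⁻¹-cong = λ p t → cong -_ (p t) }
        ; comm = λ f g t → ℤ.+-comm (f t) (g t) }
      ; *-cong = ⊛-cong
      ; *-assoc = ⊛-assoc
      ; *-identity = ⊛-identityˡ , (λ f t → trans (⊛-comm f one t) (⊛-identityˡ f t))
      ; distrib = (λ f g h t → trans (⊛-comm f (g ⊕ h) t)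
                                 (trans (⊛-distribʳ-⊕ g h f t) (cong₂ _+_ (⊛-comm g f t) (⊛-comm h f t))))
                , (λ f g h → ⊛-distribʳ-⊕ g h f) }
    ; *-comm = ⊛-comm } }

open CommutativeRing PS-ring
  using (setoid; +-cong; +-congˡ; +-congʳ; *-identityʳ; zeroˡ; zeroʳ)
  renaming (refl to ≈-refl; sym to ≈-sym; trans to ≈-trans)

⊛-congˡ : ∀ f {g g′} → g ≈ g′ → f ⊛ g ≈ f ⊛ g′
⊛-congˡ f = ⊛-cong {f = f} (λ _ → refl)

⊛-congʳ : ∀ g {f f′} → f ≈ f′ → f ⊛ g ≈ f′ ⊛ g
⊛-congʳ g f≈f′ = ⊛-cong {g = g} f≈f′ (λ _ → refl)

-- The case split makes the solver's constant 1 reduce to `one` itself.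
const : ℤ → PS
const (+ 1) = one
const c     = c · one

const≈· : ∀ c → const c ≈ c · one
const≈· (+ zero)          t = refl
const≈· (+ suc zero)      t = sym (ℤ.*-identityˡ (one t))
const≈· (+ suc (suc _))   t = refl
const≈· -[1+ _ ]          t = refl

const-⊛ : ∀ c f → const c ⊛ f ≈ c · f
const-⊛ c f t = trans (⊛-congʳ f (const≈· c) t) (trans (·-⊛ c one f t) (cong (c *_) (⊛-identityˡ f t)))

const-neg : ∀ c → const (- c) ≈ ⊖ const c
const-neg c t = trans (const≈· (- c) t) (trans (sym (ℤ.neg-distribˡ-* c (one t))) (cong -_ (sym (const≈· c t))))

const-ringHom : ℤ.+-*-rawRing -Raw-AlmostCommutative⟶ fromCommutativeRing PS-ring
const-ringHom = record
  { ⟦_⟧    = const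
  ; +-homo = λ a b t → trans (const≈· (a + b) t)
                        (trans (ℤ.*-distribʳ-+ (one t) a b) (sym (cong₂ _+_ (const≈· a t) (const≈· b t))))
  ; *-homo = λ a b t → trans (const≈· (a * b) t)
                        (trans (ℤ.*-assoc a b (one t))
                        (trans (cong (a *_) (sym (const≈· b t))) (sym (const-⊛ a (const b) t))))
  ; -‿homo = const-neg
  ; 0-homo = λ t → refl
  ; 1-homo = λ t → refl
  }

const-≟ : (a b : ℤ) → Maybe (const a ≈ const b)
const-≟ a b with a ℤ.≟ b
... | yes refl = just (λ _ → refl)
... | no  _    = nothing

open Algebra.Solver.Ring ℤ.+-*-rawRing (fromCommutativeRing PS-ring) const-ringHom const-≟
  using (solve; _:=_; con; _:+_; _:*_; :-_; _:-_)

module ≈-Reasoning = SetoidReasoning setoid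

-- Monomials and the geometric series

split-at : ∀ e {P : ℕ → Set} → (∀ t → t < e → P t) → (∀ d → P (e ℕ.+ d)) → ∀ t → P t
split-at e {P} below above t with t ℕ.<? e
... | yes t<e = below t t<e
... | no  t≮e = subst P (ℕ.m+[n∸m]≡n (ℕ.≮⇒≥ t≮e)) (above (t ∸ e))

infix 25 q^_

q^_ : ℕ → PS
q^ zero    = one
q^ (suc e) = shift (q^ e)

q^-coeff : ∀ e t → (q^ e) t ≡ (if ⌊ t ℕ.≟ e ⌋ then 1ℤ else 0ℤ)
q^-coeff zero    zero    = refl
q^-coeff zero    (suc t) = refl
q^-coeff (suc e) zero    = refl
q^-coeff (suc e) (suc t) = trans (q^-coeff e t) (cong (λ b → if b then 1ℤ else 0ℤ)
  (trans (isYes≗does (t ℕ.≟ e)) (sym (isYes≗does (suc t ℕ.≟ suc e)))))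

q^-below : ∀ e t → t < e → (q^ e) t ≡ 0ℤ
q^-below (suc e) zero    _         = refl
q^-below (suc e) (suc t) (s≤s t<e) = q^-below e t t<e

shift-cong : ∀ {f g} → f ≈ g → shift f ≈ shift g
shift-cong f≈g zero    = refl
shift-cong f≈g (suc t) = f≈g t

q^-+ : ∀ a b → q^ a ⊛ q^ b ≈ q^ (a ℕ.+ b)
q^-+ zero    b t = ⊛-identityˡ (q^ b) t
q^-+ (suc a) b t = trans (shift-⊛ (q^ a) (q^ b) t) (shift-cong (q^-+ a b) t)

q^-⊛-below : ∀ e f t → t < e → (q^ e ⊛ f) t ≡ 0ℤ
q^-⊛-below (suc e) f zero    _         = shift-⊛ (q^ e) f zero
q^-⊛-below (suc e) f (suc t) (s≤s t<e) = trans (shift-⊛ (q^ e) f (suc t)) (q^-⊛-below e f t t<e)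

q^-⊛-above : ∀ e f d → (q^ e ⊛ f) (e ℕ.+ d) ≡ f d
q^-⊛-above zero    f d = ⊛-identityˡ f d
q^-⊛-above (suc e) f d = trans (shift-⊛ (q^ e) f (suc (e ℕ.+ d))) (q^-⊛-above e f d)

onePlusQ≈ : ∀ k → onePlusQ (suc k) ≈ one ⊕ q^ (suc k)
onePlusQ≈ k zero    = refl
onePlusQ≈ k (suc t) = sym (trans (ℤ.+-identityˡ _) (q^-coeff (suc k) (suc t)))

geomQ-below : ∀ k t → t < suc k → geomQ (suc k) t ≡ one t
geomQ-below k zero    _ with suc k ∣? 0
... | yes _  = refl
... | no  k∤ = ⊥-elim (k∤ (suc k ∣0))
geomQ-below k (suc t) t<k with suc k ∣? suc t
... | yes k∣ = ⊥-elim (ℕ.<⇒≱ t<k (∣⇒≤ k∣))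
... | no  _  = refl

geomQ-periodic : ∀ k d → geomQ (suc k) (suc k ℕ.+ d) ≡ geomQ (suc k) d
geomQ-periodic k d with suc k ∣? (suc k ℕ.+ d) | suc k ∣? d
... | yes _  | yes _  = refl
... | no  _  | no  _  = refl
... | yes k∣ | no  k∤ = ⊥-elim (k∤ (∣m+n∣m⇒∣n k∣ ∣-refl))
... | no  k∤ | yes k∣ = ⊥-elim (k∤ (∣m∣n⇒∣m+n ∣-refl k∣))

geomQ-unfold : ∀ k → geomQ (suc k) ≈ one ⊕ q^ (suc k) ⊛ geomQ (suc k)
geomQ-unfold k = split-at (suc k) below above
  where
  g = geomQ (suc k)
  below : ∀ t → t < suc k → g t ≡ one t + (q^ (suc k) ⊛ g) t
  below t t<k = trans (geomQ-below k t t<k)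
                  (sym (trans (cong (_+_ (one t)) (q^-⊛-below (suc k) g t t<k)) (ℤ.+-identityʳ (one t))))
  above : ∀ d → g (suc k ℕ.+ d) ≡ one (suc k ℕ.+ d) + (q^ (suc k) ⊛ g) (suc k ℕ.+ d)
  above d = trans (geomQ-periodic k d) (sym (trans (ℤ.+-identityˡ _) (q^-⊛-above (suc k) g d)))

geomQ-inverse : ∀ k → (one ⊕ ⊖ q^ (suc k)) ⊛ geomQ (suc k) ≈ one
geomQ-inverse k = begin
  (one ⊕ ⊖ x) ⊛ g            ≈⟨ solve 2 (λ x g → (con 1ℤ :- x) :* g := g :- x :* g) ≈-refl x g ⟩
  g ⊕ ⊖ (x ⊛ g)              ≈⟨ +-congʳ (geomQ-unfold k) ⟩
  one ⊕ x ⊛ g ⊕ ⊖ (x ⊛ g)    ≈⟨ solve 2 (λ x g → con 1ℤ :+ x :* g :- x :* g := con 1ℤ) ≈-refl x g ⟩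
  one                        ∎
  where
  open ≈-Reasoning
  x = q^ (suc k)
  g = geomQ (suc k)

-- Agreement up to a degree

infix 4 _≈[_]_

_≈[_]_ : PS → ℕ → PS → Set
f ≈[ T ] g = ∀ t → t ≤ T → f t ≡ g t

≈⇒≈[] : ∀ {f g} T → f ≈ g → f ≈[ T ] g
≈⇒≈[] T f≈g t _ = f≈g t

≈[]-weaken : ∀ {f g T T′} → T′ ≤ T → f ≈[ T ] g → f ≈[ T′ ] g
≈[]-weaken T′≤T f≈g t t≤T′ = f≈g t (ℕ.≤-trans t≤T′ T′≤T)

truncated : ℕ → Setoid 0ℓ 0ℓ
truncated T = record
  { Carrier = PS ; _≈_ = _≈[ T ]_
  ; isEquivalence = record
    { refl = λ _ _ → refl ; sym = λ p t t≤T → sym (p t t≤T) ; trans = λ p q t t≤T → trans (p t t≤T) (q t t≤T) } }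

module ≈[]-Reasoning (T : ℕ) = SetoidReasoning (truncated T)

⊛-cong[] : ∀ {f f′ g g′ T} → f ≈[ T ] f′ → g ≈[ T ] g′ → f ⊛ g ≈[ T ] f′ ⊛ g′
⊛-cong[] {f} {f′} {g} {g′} f≈f′ g≈g′ t t≤T = begin
  (f ⊛ g) t                             ≡⟨ ⊛-coeff f g t ⟩
  ∑[ i < suc t ] (f i * g (t ∸ i))      ≡⟨ ∑-cong (suc t) (λ i i≤t → cong₂ _*_
                                             (f≈f′ i (ℕ.≤-trans (ℕ.≤-pred i≤t) t≤T))
                                             (g≈g′ (t ∸ i) (ℕ.≤-trans (ℕ.m∸n≤m t i) t≤T))) ⟩
  ∑[ i < suc t ] (f′ i * g′ (t ∸ i))    ≡⟨ sym (⊛-coeff f′ g′ t) ⟩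
  (f′ ⊛ g′) t                           ∎
  where open ≡-Reasoning

⊛-congˡ[] : ∀ f {g g′ T} → g ≈[ T ] g′ → f ⊛ g ≈[ T ] f ⊛ g′
⊛-congˡ[] f = ⊛-cong[] {f = f} (λ _ _ → refl)

⊛-congʳ[] : ∀ g {f f′ T} → f ≈[ T ] f′ → f ⊛ g ≈[ T ] f′ ⊛ g
⊛-congʳ[] g f≈f′ = ⊛-cong[] {g = g} f≈f′ (λ _ _ → refl)

q^-⊛-cong[] : ∀ e {f g T} → f ≈[ T ] g → q^ e ⊛ f ≈[ e ℕ.+ T ] q^ e ⊛ g
q^-⊛-cong[] zero    {f} {g} f≈g t t≤T = trans (⊛-identityˡ f t) (trans (f≈g t t≤T) (sym (⊛-identityˡ g t)))
q^-⊛-cong[] (suc e) {f} {g} f≈g zero    _ = trans (shift-⊛ (q^ e) f 0) (sym (shift-⊛ (q^ e) g 0))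
q^-⊛-cong[] (suc e) {f} {g} f≈g (suc t) (s≤s t≤T) =
  trans (shift-⊛ (q^ e) f (suc t)) (trans (q^-⊛-cong[] e f≈g t t≤T) (sym (shift-⊛ (q^ e) g (suc t))))

onePlusQ≈[]one : ∀ k → onePlusQ (suc k) ≈[ k ] one
onePlusQ≈[]one k t t≤k =
  trans (onePlusQ≈ k t) (trans (cong (_+_ (one t)) (q^-below (suc k) t (s≤s t≤k))) (ℤ.+-identityʳ (one t)))

geomQ≈[]one : ∀ k → geomQ (suc k) ≈[ k ] one
geomQ≈[]one k t t≤k = geomQ-below k t (s≤s t≤k)

factor≈[]one : ∀ k → factor (suc k) ≈[ k ] one
factor≈[]one k t t≤k = trans (⊛-cong[] (onePlusQ≈[]one k) (geomQ≈[]one k) t t≤k) (⊛-identityˡ one t)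

-- ∏ g a = g 1 ⊛ ⋯ ⊛ g a; the value g 0 is never used.
∏ : (ℕ → PS) → ℕ → PS
∏ g zero    = one
∏ g (suc a) = ∏ g a ⊛ g (suc a)

∏-cong : ∀ {g h} → (∀ i → g (suc i) ≈ h (suc i)) → ∀ a → ∏ g a ≈ ∏ h a
∏-cong g≈h zero    = ≈-refl
∏-cong g≈h (suc a) = ⊛-cong (∏-cong g≈h a) (g≈h a)

∏-one : ∀ {g} → (∀ i → g (suc i) ≈ one) → ∀ a → ∏ g a ≈ one
∏-one g≈1 zero    = ≈-refl
∏-one g≈1 (suc a) = ≈-trans (⊛-cong (∏-one g≈1 a) (g≈1 a)) (⊛-identityˡ one)

∏-⊛ : ∀ g h a → ∏ g a ⊛ ∏ h a ≈ ∏ (λ i → g i ⊛ h i) a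
∏-⊛ g h zero    = ⊛-identityˡ one
∏-⊛ g h (suc a) = ≈-trans (interchange (∏ g a) (g (suc a)) (∏ h a) (h (suc a))) (⊛-congʳ (g (suc a) ⊛ h (suc a)) (∏-⊛ g h a))
  where
  interchange : ∀ x y z w → (x ⊛ y) ⊛ (z ⊛ w) ≈ (x ⊛ z) ⊛ (y ⊛ w)
  interchange = solve 4 (λ x y z w → (x :* y) :* (z :* w) := (x :* z) :* (y :* w)) ≈-refl

∏-stable : ∀ g (b : ℕ → ℕ) → (∀ {i j} → i ≤ j → b i ≤ b j) → (∀ i → g (suc i) ≈[ b i ] one) →
           ∀ {a c} → a ≤ c → ∏ g c ≈[ b a ] ∏ g a
∏-stable g b mono g≈1 {a} a≤c with ℕ.m≤n⇒∃[o]m+o≡n a≤c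
... | d , refl = extend d
  where
  extend : ∀ d → ∏ g (a ℕ.+ d) ≈[ b a ] ∏ g a
  extend zero t t≤b rewrite ℕ.+-identityʳ a = refl
  extend (suc d) = begin
    ∏ g (a ℕ.+ suc d)             ≡⟨ cong (∏ g) (ℕ.+-suc a d) ⟩
    ∏ g (a ℕ.+ d) ⊛ g (suc (a ℕ.+ d))
      ≈⟨ ≈[]-weaken (mono (ℕ.m≤m+n a d)) (⊛-congˡ[] (∏ g (a ℕ.+ d)) (g≈1 (a ℕ.+ d))) ⟩
    ∏ g (a ℕ.+ d) ⊛ one           ≈⟨ ≈⇒≈[] (b a) (*-identityʳ (∏ g (a ℕ.+ d))) ⟩
    ∏ g (a ℕ.+ d)                 ≈⟨ extend d ⟩
    ∏ g a                         ∎
    where open ≈[]-Reasoning (b a)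

-- The finite form of Gauss's identity

double : ℕ → ℕ
double zero    = zero
double (suc n) = suc (suc (double n))

double≡+ : ∀ n → double n ≡ n ℕ.+ n
double≡+ zero    = refl
double≡+ (suc n) = cong suc (trans (cong suc (double≡+ n)) (sym (ℕ.+-suc n n)))

double-+ : ∀ a b → double (a ℕ.+ b) ≡ double a ℕ.+ double b
double-+ zero    b = refl
double-+ (suc a) b = cong (suc ∘ suc) (double-+ a b)

double-mono : ∀ {a b} → a ≤ b → double a ≤ double b
double-mono {a} {b} a≤b = subst₂ _≤_ (sym (double≡+ a)) (sym (double≡+ b)) (ℕ.+-mono-≤ a≤b a≤b)

infix 25 q²^_

q²^_ : ℕ → PS
q²^ e = q^ (double e)

q²^-+ : ∀ a b → q²^ a ⊛ q²^ b ≈ q²^ (a ℕ.+ b)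
q²^-+ a b t = trans (q^-+ (double a) (double b) t) (cong (λ e → (q^ e) t) (sym (double-+ a b)))

P : ℕ → PS
P = ∏ (geomQ ∘ double)

P-unstep : ∀ a → (one ⊕ ⊖ q²^ suc a) ⊛ P (suc a) ≈ P a
P-unstep a = begin
  (one ⊕ ⊖ x) ⊛ (P a ⊛ g)  ≈⟨ solve 3 (λ x p g → (con 1ℤ :- x) :* (p :* g) := p :* ((con 1ℤ :- x) :* g)) ≈-refl x (P a) g ⟩
  P a ⊛ ((one ⊕ ⊖ x) ⊛ g)  ≈⟨ ⊛-congˡ (P a) (geomQ-inverse (suc (double a))) ⟩
  P a ⊛ one                ≈⟨ *-identityʳ (P a) ⟩
  P a                      ∎
  where
  open ≈-Reasoning
  x = q²^ suc a
  g = geomQ (double (suc a))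

Pℤ : ℤ → PS
Pℤ (+ a)      = P a
Pℤ -[1+ _ ]   = 0ₛ

Pℤ-pred : ∀ x → Pℤ (x - 1ℤ) ≈ (one ⊕ ⊖ q²^ ∣ x ∣) ⊛ Pℤ x
Pℤ-pred (+ zero)    = ≈-sym (≈-trans (⊛-congʳ one (λ t → ℤ.+-inverseʳ (one t))) (zeroˡ one))
Pℤ-pred (+ suc a)   = ≈-sym (P-unstep a)
Pℤ-pred -[1+ n ]    = ≈-sym (zeroʳ (one ⊕ ⊖ q²^ suc n))

Pℤ-unfold : ∀ x → Pℤ x ≈ Pℤ (x - 1ℤ) ⊕ q²^ ∣ x ∣ ⊛ Pℤ x
Pℤ-unfold x = begin
  Pℤ x                                              ≈⟨ solve 2 (λ a p → p := (con 1ℤ :- a) :* p :+ a :* p) ≈-refl a (Pℤ x) ⟩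
  (one ⊕ ⊖ a) ⊛ Pℤ x ⊕ a ⊛ Pℤ x                     ≈⟨ +-congʳ (≈-sym (Pℤ-pred x)) ⟩
  Pℤ (x - 1ℤ) ⊕ a ⊛ Pℤ x                            ∎
  where
  open ≈-Reasoning
  a = q²^ ∣ x ∣

-- 1 − q^{2(a+b)} = (1 − q^{2b}) + q^{2b} (1 − q^{2a}), applied to P a P b.
Pℤ-split : ∀ x y s → x + y ≡ + s →
           (one ⊕ ⊖ q²^ s) ⊛ (Pℤ x ⊛ Pℤ y) ≈ Pℤ x ⊛ Pℤ (y - 1ℤ) ⊕ q²^ ∣ y ∣ ⊛ (Pℤ (x - 1ℤ) ⊛ Pℤ y)
Pℤ-split -[1+ m ] y s _ = begin
  (one ⊕ ⊖ q²^ s) ⊛ (0ₛ ⊛ Pℤ y)                          ≈⟨ ⊛-congˡ (one ⊕ ⊖ q²^ s) (zeroˡ (Pℤ y)) ⟩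
  (one ⊕ ⊖ q²^ s) ⊛ 0ₛ                                   ≈⟨ zeroʳ (one ⊕ ⊖ q²^ s) ⟩
  0ₛ ⊕ 0ₛ                                                ≈⟨ +-cong (zeroˡ (Pℤ (y - 1ℤ)))
                                                              (≈-trans (⊛-congˡ (q²^ ∣ y ∣) (zeroˡ (Pℤ y))) (zeroʳ (q²^ ∣ y ∣))) ⟨
  0ₛ ⊛ Pℤ (y - 1ℤ) ⊕ q²^ ∣ y ∣ ⊛ (0ₛ ⊛ Pℤ y)              ∎
  where open ≈-Reasoning
Pℤ-split (+ a) -[1+ n ] s _ = begin
  (one ⊕ ⊖ q²^ s) ⊛ (P a ⊛ 0ₛ)                           ≈⟨ ⊛-congˡ (one ⊕ ⊖ q²^ s) (zeroʳ (P a)) ⟩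
  (one ⊕ ⊖ q²^ s) ⊛ 0ₛ                                   ≈⟨ zeroʳ (one ⊕ ⊖ q²^ s) ⟩
  0ₛ ⊕ 0ₛ                                                ≈⟨ +-cong (zeroʳ (P a))
                                                              (≈-trans (⊛-congˡ (q²^ suc n) (zeroʳ (Pℤ (+ a - 1ℤ)))) (zeroʳ (q²^ suc n))) ⟨
  P a ⊛ 0ₛ ⊕ q²^ suc n ⊛ (Pℤ (+ a - 1ℤ) ⊛ 0ₛ)            ∎
  where open ≈-Reasoning
Pℤ-split (+ a) (+ b) s a+b≡s = begin
  (one ⊕ ⊖ q²^ s) ⊛ (P a ⊛ P b)
    ≈⟨ ⊛-congʳ (P a ⊛ P b) (+-congˡ {one} (λ t → cong -_ (sym (trans (q²^-+ a b t) (cong (λ e → (q²^ e) t) (ℤ.+-injective a+b≡s)))))) ⟩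
  (one ⊕ ⊖ (q²^ a ⊛ q²^ b)) ⊛ (P a ⊛ P b)
    ≈⟨ solve 4 (λ u v A B → (con 1ℤ :- A :* B) :* (u :* v) := u :* ((con 1ℤ :- B) :* v) :+ B :* (((con 1ℤ :- A) :* u) :* v))
             ≈-refl (P a) (P b) (q²^ a) (q²^ b) ⟩
  P a ⊛ ((one ⊕ ⊖ q²^ b) ⊛ P b) ⊕ q²^ b ⊛ (((one ⊕ ⊖ q²^ a) ⊛ P a) ⊛ P b)
    ≈⟨ +-cong (⊛-congˡ (P a) (Pℤ-pred (+ b))) (⊛-congˡ (q²^ b) (⊛-congʳ (P b) (Pℤ-pred (+ a)))) ⟨
  Pℤ (+ a) ⊛ Pℤ (+ b - 1ℤ) ⊕ q²^ b ⊛ (Pℤ (+ a - 1ℤ) ⊛ P b) ∎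
  where open ≈-Reasoning

sgn : ℤ → ℤ
sgn k = -1ℤ ℤ.^ ∣ k ∣

sgn-neg : ∀ k → sgn (- k) ≡ sgn k
sgn-neg k = cong (-1ℤ ℤ.^_) (ℤ.∣-i∣≡∣i∣ k)

sgn-suc : ∀ k → sgn (1ℤ + k) ≡ - sgn k
sgn-suc (+ n)           = ℤ.-1*i≡-i (sgn (+ n))
sgn-suc -[1+ zero ]     = refl
sgn-suc -[1+ suc n ]    = sym (trans (cong -_ (ℤ.-1*i≡-i (sgn -[1+ n ]))) (ℤ.neg-involutive _))

sgn-1- : ∀ k → sgn (1ℤ - k) ≡ - sgn k
sgn-1- k = trans (sgn-suc (- k)) (cong -_ (sgn-neg k))

sgn--1- : ∀ k → sgn (-1ℤ - k) ≡ - sgn k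
sgn--1- k = trans (cong sgn (-1-k≡-[1+k] k)) (trans (sgn-neg (1ℤ + k)) (sgn-suc k))
  where
  -1-k≡-[1+k] : ∀ k → -1ℤ - k ≡ - (1ℤ + k)
  -1-k≡-[1+k] = solve-∀

sq : ℤ → ℕ
sq k = ∣ k ∣ ℕ.* ∣ k ∣

+sq : ∀ k → + sq k ≡ k * k
+sq (+ n)    = ℤ.pos-* n n
+sq -[1+ n ] = refl

term : ℤ → ℕ → ℤ → ℤ → PS
term s e x y = const s ⊛ (q²^ e ⊛ (Pℤ x ⊛ Pℤ y))

term-vanishes : ∀ s e x y → Pℤ x ⊛ Pℤ y ≈ 0ₛ → term s e x y ≈ 0ₛ
term-vanishes s e x y P≈0 = begin
  const s ⊛ (q²^ e ⊛ (Pℤ x ⊛ Pℤ y))   ≈⟨ ⊛-congˡ (const s) (⊛-congˡ (q²^ e) P≈0) ⟩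
  const s ⊛ (q²^ e ⊛ 0ₛ)              ≈⟨ ⊛-congˡ (const s) (zeroʳ (q²^ e)) ⟩
  const s ⊛ 0ₛ                        ≈⟨ zeroʳ (const s) ⟩
  0ₛ                                  ∎
  where open ≈-Reasoning

term-negˡ : ∀ s e n y → term s e -[1+ n ] y ≈ 0ₛ
term-negˡ s e n y = term-vanishes s e -[1+ n ] y (zeroˡ (Pℤ y))

term-negʳ : ∀ s e x n → term s e x -[1+ n ] ≈ 0ₛ
term-negʳ s e x n = term-vanishes s e x -[1+ n ] (zeroʳ (Pℤ x))

term-vanishesˡ : ∀ s e x y → x ≡ -1ℤ → term s e x y ≈ 0ₛ
term-vanishesˡ s e x y refl = term-negˡ s e 0 y

term-vanishesʳ : ∀ s e x y → y ≡ -1ℤ → term s e x y ≈ 0ₛ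
term-vanishesʳ s e x y refl = term-negʳ s e x 0

term-swap : ∀ s e e′ x y → (0ℤ ℤ.≤ x → 0ℤ ℤ.≤ y → e′ ≡ e) → term (- s) e′ y x ≈ ⊖ term s e x y
term-swap s e e′ -[1+ n ] y _ t = trans (term-negʳ (- s) e′ y n t) (cong -_ (sym (term-negˡ s e n y t)))
term-swap s e e′ (+ a) -[1+ n ] _ t = trans (term-negˡ (- s) e′ n (+ a) t) (cong -_ (sym (term-negʳ s e (+ a) n t)))
term-swap s e e′ (+ a) (+ b) e′≡e rewrite e′≡e (ℤ.+≤+ z≤n) (ℤ.+≤+ z≤n) = begin
  const (- s) ⊛ (q²^ e ⊛ (P b ⊛ P a))     ≈⟨ ⊛-congʳ (q²^ e ⊛ (P b ⊛ P a)) (const-neg s) ⟩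
  (⊖ const s) ⊛ (q²^ e ⊛ (P b ⊛ P a))     ≈⟨ solve 4 (λ c x u v → (:- c) :* (x :* (v :* u)) := :- (c :* (x :* (u :* v))))
                                                ≈-refl (const s) (q²^ e) (P a) (P b) ⟩
  ⊖ (const s ⊛ (q²^ e ⊛ (P a ⊛ P b)))     ∎
  where open ≈-Reasoning

∑ₛ : ℤ → ℕ → (ℤ → PS) → PS
∑ₛ lo len F t = ∑[ i < len ] F (lo + + i) t

∑ₛ-cong : ∀ lo len {F G} → (∀ k → F k ≈ G k) → ∑ₛ lo len F ≈ ∑ₛ lo len G
∑ₛ-cong lo len F≈G t = ∑-cong len (λ i _ → F≈G (lo + + i) t)

∑ₛ-cong[] : ∀ lo len {F G T} → (∀ i → i < len → F (lo + + i) ≈[ T ] G (lo + + i)) → ∑ₛ lo len F ≈[ T ] ∑ₛ lo len G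
∑ₛ-cong[] lo len F≈G t t≤T = ∑-cong len (λ i i<len → F≈G i i<len t t≤T)

∑ₛ-⊕ : ∀ lo len F G → ∑ₛ lo len (λ k → F k ⊕ G k) ≈ ∑ₛ lo len F ⊕ ∑ₛ lo len G
∑ₛ-⊕ lo len F G t = ∑-distrib-+ len (λ i → F (lo + + i) t) (λ i → G (lo + + i) t)

⊛-∑ₛ : ∀ g lo len F → g ⊛ ∑ₛ lo len F ≈ ∑ₛ lo len (λ k → g ⊛ F k)
⊛-∑ₛ g lo len F t = begin
  (g ⊛ ∑ₛ lo len F) t                                       ≡⟨ ⊛-coeff g (∑ₛ lo len F) t ⟩
  ∑[ i < suc t ] (g i * ∑[ j < len ] F (lo + + j) (t ∸ i))  ≡⟨ ∑-cong (suc t) (λ i _ → sym (∑-distribˡ-* len (g i) (λ j → F (lo + + j) (t ∸ i)))) ⟩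
  ∑[ i < suc t ] ∑[ j < len ] (g i * F (lo + + j) (t ∸ i))  ≡⟨ ∑-comm (suc t) len (λ i j → g i * F (lo + + j) (t ∸ i)) ⟩
  ∑[ j < len ] ∑[ i < suc t ] (g i * F (lo + + j) (t ∸ i))  ≡⟨ ∑-cong len (λ j _ → sym (⊛-coeff g (F (lo + + j)) t)) ⟩
  ∑ₛ lo len (λ k → g ⊛ F k) t                               ∎
  where open ≡-Reasoning

∑ₛ-⊛ : ∀ g lo len F → ∑ₛ lo len F ⊛ g ≈ ∑ₛ lo len (λ k → F k ⊛ g)
∑ₛ-⊛ g lo len F = ≈-trans (⊛-comm (∑ₛ lo len F) g) (≈-trans (⊛-∑ₛ g lo len F) (∑ₛ-cong lo len (λ k → ⊛-comm g (F k))))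

∑ₛ-head : ∀ lo len F → ∑ₛ lo (suc len) F ≈ F lo ⊕ ∑ₛ (lo + 1ℤ) len F
∑ₛ-head lo len F t =
  cong₂ _+_ (cong (λ k → F k t) (ℤ.+-identityʳ lo)) (∑-cong len (λ i _ → cong (λ k → F k t) (reassoc lo (+ i))))
  where
  reassoc : ∀ lo i → lo + (1ℤ + i) ≡ lo + 1ℤ + i
  reassoc = solve-∀

∑ₛ-last : ∀ lo len F → ∑ₛ lo (suc len) F ≈ ∑ₛ lo len F ⊕ F (lo + + len)
∑ₛ-last lo len F t = ∑-last len (λ i → F (lo + + i) t)

-- The reflection k ↦ c − k maps the range lo … lo + len − 1 onto itself.
∑ₛ-antisymmetric : ∀ lo len c F → lo + lo + + len ≡ c + 1ℤ → (∀ k → F (c - k) ≈ ⊖ F k) → ∑ₛ lo len F ≈ 0ₛ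
∑ₛ-antisymmetric lo len c F range anti t =
  ∑-antisymmetric len (λ i → F (lo + + i) t) (λ i j i+j+1≡len → trans (cong (λ k → F k t) (reflect i j i+j+1≡len)) (anti (lo + + j) t))
  where
  reflect : ∀ i j → suc (i ℕ.+ j) ≡ len → lo + + i ≡ c - (lo + + j)
  reflect i j i+j+1≡len = begin
    lo + + i                                   ≡⟨ rearrange lo c (+ i) (+ j) ⟩
    lo + lo + (1ℤ + + i + + j) - 1ℤ - (lo + + j) ≡⟨ cong (λ m → lo + lo + + m - 1ℤ - (lo + + j)) i+j+1≡len ⟩
    lo + lo + + len - 1ℤ - (lo + + j)          ≡⟨ cong (λ m → m - 1ℤ - (lo + + j)) range ⟩
    c + 1ℤ - 1ℤ - (lo + + j)                   ≡⟨ cancel c (lo + + j) ⟩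
    c - (lo + + j)                             ∎
    where
    open ≡-Reasoning
    rearrange : ∀ lo c i j → lo + i ≡ lo + lo + (1ℤ + i + j) - 1ℤ - (lo + j)
    rearrange = solve-∀
    cancel : ∀ c u → c + 1ℤ - 1ℤ - u ≡ c - u
    cancel = solve-∀

term-cong : ∀ {s s′ e e′ x x′ y y′} → s ≡ s′ → e ≡ e′ → x ≡ x′ → y ≡ y′ → term s e x y ≈ term s′ e′ x′ y′
term-cong refl refl refl refl = ≈-refl

sq+∣∣-cong : ∀ a b {u v} → 0ℤ ℤ.≤ u → 0ℤ ℤ.≤ v → a * a + u ≡ b * b + v → sq a ℕ.+ ∣ u ∣ ≡ sq b ℕ.+ ∣ v ∣
sq+∣∣-cong a b {u} {v} 0≤u 0≤v eq = ℤ.+-injective (begin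
  + (sq a ℕ.+ ∣ u ∣)     ≡⟨ ℤ.pos-+ (sq a) ∣ u ∣ ⟩
  + sq a + + ∣ u ∣       ≡⟨ cong₂ _+_ (+sq a) (ℤ.0≤i⇒+∣i∣≡i 0≤u) ⟩
  a * a + u              ≡⟨ eq ⟩
  b * b + v              ≡⟨ cong₂ _+_ (+sq b) (ℤ.0≤i⇒+∣i∣≡i 0≤v) ⟨
  + sq b + + ∣ v ∣       ≡⟨ ℤ.pos-+ (sq b) ∣ v ∣ ⟨
  + (sq b ℕ.+ ∣ v ∣)     ∎)
  where open ≡-Reasoning

+double : ∀ n → + double n ≡ + n + + n
+double n = trans (cong +_ (double≡+ n)) (ℤ.pos-+ n n)

gaussTerm : ℕ → ℤ → PS
gaussTerm n k = term (sgn k) (sq k) (+ n + k) (+ n - k)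

gaussSum : ℕ → PS
gaussSum n = ∑ₛ (- + n) (suc (double n)) (gaussTerm n)

Q : ℕ → PS
Q = ∏ (geomQ ∘ double ∘ double)

gaussTermʳ gaussTermˡʳ oddˡ oddʳ : ℕ → ℤ → PS
gaussTermʳ  n k = term (sgn k) (sq k) (+ n + k) (+ n - k - 1ℤ)
gaussTermˡʳ n k = term (sgn k) (sq k) (+ n + k - 1ℤ) (+ n - k - 1ℤ)
oddˡ        n k = term (sgn k) (sq k ℕ.+ ∣ + n - k ∣) (+ n + k - 1ℤ) (+ n - k)
oddʳ        n k = term (sgn k) (sq k ℕ.+ ∣ + n + k ∣) (+ n + k) (+ n - k - 1ℤ)

gaussTerm-split : ∀ n k → (one ⊕ ⊖ q²^ double n) ⊛ gaussTerm n k ≈ gaussTermʳ n k ⊕ oddˡ n k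
gaussTerm-split n k = begin
  d ⊛ (c ⊛ (a ⊛ (Pℤ x ⊛ Pℤ y)))
    ≈⟨ solve 4 (λ d c a u → d :* (c :* (a :* u)) := c :* (a :* (d :* u))) ≈-refl d c a (Pℤ x ⊛ Pℤ y) ⟩
  c ⊛ (a ⊛ (d ⊛ (Pℤ x ⊛ Pℤ y)))
    ≈⟨ ⊛-congˡ c (⊛-congˡ a (Pℤ-split x y (double n) x+y≡2n)) ⟩
  c ⊛ (a ⊛ (Pℤ x ⊛ Pℤ (y - 1ℤ) ⊕ b ⊛ (Pℤ (x - 1ℤ) ⊛ Pℤ y)))
    ≈⟨ solve 5 (λ c a u b v → c :* (a :* (u :+ b :* v)) := c :* (a :* u) :+ c :* ((a :* b) :* v))
             ≈-refl c a (Pℤ x ⊛ Pℤ (y - 1ℤ)) b (Pℤ (x - 1ℤ) ⊛ Pℤ y) ⟩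
  gaussTermʳ n k ⊕ c ⊛ ((a ⊛ b) ⊛ (Pℤ (x - 1ℤ) ⊛ Pℤ y))
    ≈⟨ +-congˡ {gaussTermʳ n k} (⊛-congˡ c (⊛-congʳ (Pℤ (x - 1ℤ) ⊛ Pℤ y) (q²^-+ (sq k) ∣ y ∣))) ⟩
  gaussTermʳ n k ⊕ oddˡ n k ∎
  where
  open ≈-Reasoning
  d = one ⊕ ⊖ q²^ double n
  c = const (sgn k)
  a = q²^ sq k
  x = + n + k
  y = + n - k
  b = q²^ ∣ y ∣
  x+y≡2n : x + y ≡ + double n
  x+y≡2n = trans (lemma (+ n) k) (sym (+double n))
    where
    lemma : ∀ n k → n + k + (n - k) ≡ n + n
    lemma = solve-∀

gaussTermʳ-split : ∀ n k → gaussTermʳ n k ≈ gaussTermˡʳ n k ⊕ oddʳ n k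
gaussTermʳ-split n k = begin
  c ⊛ (a ⊛ (Pℤ x ⊛ Pℤ y))
    ≈⟨ ⊛-congˡ c (⊛-congˡ a (⊛-congʳ (Pℤ y) (Pℤ-unfold x))) ⟩
  c ⊛ (a ⊛ ((Pℤ (x - 1ℤ) ⊕ b ⊛ Pℤ x) ⊛ Pℤ y))
    ≈⟨ solve 6 (λ c a u b w v → c :* (a :* ((u :+ b :* w) :* v)) := c :* (a :* (u :* v)) :+ c :* ((a :* b) :* (w :* v)))
             ≈-refl c a (Pℤ (x - 1ℤ)) b (Pℤ x) (Pℤ y) ⟩
  gaussTermˡʳ n k ⊕ c ⊛ ((a ⊛ b) ⊛ (Pℤ x ⊛ Pℤ y))
    ≈⟨ +-congˡ {gaussTermˡʳ n k} (⊛-congˡ c (⊛-congʳ (Pℤ x ⊛ Pℤ y) (q²^-+ (sq k) ∣ x ∣))) ⟩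
  gaussTermˡʳ n k ⊕ oddʳ n k ∎
  where
  open ≈-Reasoning
  c = const (sgn k)
  a = q²^ sq k
  x = + n + k
  y = + n - k - 1ℤ
  b = q²^ ∣ x ∣

oddˡ-antisymmetric : ∀ n k → oddˡ n (1ℤ - k) ≈ ⊖ oddˡ n k
oddˡ-antisymmetric n k = ≈-trans
  (term-cong {e = e′} (sgn-1- k) refl (x′≡y (+ n) k) (y′≡x (+ n) k))
  (term-swap (sgn k) (sq k ℕ.+ ∣ + n - k ∣) e′ (+ n + k - 1ℤ) (+ n - k) λ 0≤x 0≤y →
    sq+∣∣-cong (1ℤ - k) k (subst (0ℤ ℤ.≤_) (sym (y′≡x (+ n) k)) 0≤x) 0≤y (exponent (+ n) k))
  where
  e′ = sq (1ℤ - k) ℕ.+ ∣ + n - (1ℤ - k) ∣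
  x′≡y : ∀ n k → n + (1ℤ - k) - 1ℤ ≡ n - k
  x′≡y = solve-∀
  y′≡x : ∀ n k → n - (1ℤ - k) ≡ n + k - 1ℤ
  y′≡x = solve-∀
  exponent : ∀ n k → (1ℤ - k) * (1ℤ - k) + (n - (1ℤ - k)) ≡ k * k + (n - k)
  exponent = solve-∀

oddʳ-antisymmetric : ∀ n k → oddʳ n (-1ℤ - k) ≈ ⊖ oddʳ n k
oddʳ-antisymmetric n k = ≈-trans
  (term-cong {e = e′} (sgn--1- k) refl (x′≡y (+ n) k) (y′≡x (+ n) k))
  (term-swap (sgn k) (sq k ℕ.+ ∣ + n + k ∣) e′ (+ n + k) (+ n - k - 1ℤ) λ 0≤x 0≤y →
    sq+∣∣-cong (-1ℤ - k) k (subst (0ℤ ℤ.≤_) (sym (x′≡y (+ n) k)) 0≤y) 0≤x (exponent (+ n) k))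
  where
  e′ = sq (-1ℤ - k) ℕ.+ ∣ + n + (-1ℤ - k) ∣
  x′≡y : ∀ n k → n + (-1ℤ - k) ≡ n - k - 1ℤ
  x′≡y = solve-∀
  y′≡x : ∀ n k → n - (-1ℤ - k) - 1ℤ ≡ n + k
  y′≡x = solve-∀
  exponent : ∀ n k → (-1ℤ - k) * (-1ℤ - k) + (n + (-1ℤ - k)) ≡ k * k + (n + k)
  exponent = solve-∀

lowSum : ℕ → PS
lowSum n = ∑ₛ (- + n) (double n) (gaussTermʳ n)

gaussSum-telescope : ∀ n → (one ⊕ ⊖ q²^ double n) ⊛ gaussSum n ≈ lowSum n
gaussSum-telescope n = begin
  d ⊛ ∑ₛ lo (suc L) (gaussTerm n)                          ≈⟨ ⊛-∑ₛ d lo (suc L) (gaussTerm n) ⟩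
  ∑ₛ lo (suc L) (λ k → d ⊛ gaussTerm n k)                  ≈⟨ ∑ₛ-cong lo (suc L) (gaussTerm-split n) ⟩
  ∑ₛ lo (suc L) (λ k → gaussTermʳ n k ⊕ oddˡ n k)          ≈⟨ ∑ₛ-⊕ lo (suc L) (gaussTermʳ n) (oddˡ n) ⟩
  ∑ₛ lo (suc L) (gaussTermʳ n) ⊕ ∑ₛ lo (suc L) (oddˡ n)    ≈⟨ +-cong (∑ₛ-last lo L (gaussTermʳ n)) (∑ₛ-head lo L (oddˡ n)) ⟩
  lowSum n ⊕ gaussTermʳ n (lo + + L) ⊕ (oddˡ n lo ⊕ ∑ₛ (lo + 1ℤ) L (oddˡ n))
    ≈⟨ +-cong (+-congˡ {lowSum n} top-vanishes)
              (+-cong bottom-vanishes (∑ₛ-antisymmetric (lo + 1ℤ) L 1ℤ (oddˡ n) range (oddˡ-antisymmetric n))) ⟩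
  lowSum n ⊕ 0ₛ ⊕ (0ₛ ⊕ 0ₛ)                                ≈⟨ (λ t → trans (ℤ.+-identityʳ _) (ℤ.+-identityʳ _)) ⟩
  lowSum n                                                 ∎
  where
  open ≈-Reasoning
  d = one ⊕ ⊖ q²^ double n
  lo = - + n
  L = double n
  top-vanishes : gaussTermʳ n (lo + + L) ≈ 0ₛ
  top-vanishes = term-vanishesʳ (sgn k) (sq k) (+ n + k) (+ n - k - 1ℤ)
                   (trans (cong (λ m → + n - (lo + m) - 1ℤ) (+double n)) (lemma (+ n)))
    where
    k = lo + + L
    lemma : ∀ n → n - (- n + (n + n)) - 1ℤ ≡ -1ℤ
    lemma = solve-∀
  bottom-vanishes : oddˡ n lo ≈ 0ₛ
  bottom-vanishes = term-vanishesˡ (sgn lo) (sq lo ℕ.+ ∣ + n - lo ∣) (+ n + lo - 1ℤ) (+ n - lo) (lemma (+ n))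
    where
    lemma : ∀ n → n + - n - 1ℤ ≡ -1ℤ
    lemma = solve-∀
  range : lo + 1ℤ + (lo + 1ℤ) + + L ≡ 1ℤ + 1ℤ
  range = trans (cong (λ m → lo + 1ℤ + (lo + 1ℤ) + m) (+double n)) (lemma (+ n))
    where
    lemma : ∀ n → - n + 1ℤ + (- n + 1ℤ) + (n + n) ≡ 1ℤ + 1ℤ
    lemma = solve-∀

lowSum-shift : ∀ m → lowSum (suc m) ≈ gaussSum m
lowSum-shift m = begin
  ∑ₛ lo L (gaussTermʳ n)                                   ≈⟨ ∑ₛ-cong lo L (gaussTermʳ-split n) ⟩
  ∑ₛ lo L (λ k → gaussTermˡʳ n k ⊕ oddʳ n k)               ≈⟨ ∑ₛ-⊕ lo L (gaussTermˡʳ n) (oddʳ n) ⟩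
  ∑ₛ lo L (gaussTermˡʳ n) ⊕ ∑ₛ lo L (oddʳ n)               ≈⟨ +-cong (∑ₛ-head lo (suc (double m)) (gaussTermˡʳ n))
                                                                      (∑ₛ-antisymmetric lo L -1ℤ (oddʳ n) range (oddʳ-antisymmetric n)) ⟩
  gaussTermˡʳ n lo ⊕ ∑ₛ (lo + 1ℤ) (suc (double m)) (gaussTermˡʳ n) ⊕ 0ₛ
    ≈⟨ +-congʳ (+-cong bottom-vanishes (λ t → cong (λ k → ∑ₛ k (suc (double m)) (gaussTermˡʳ n) t) (lo+1≡ (+ m)))) ⟩
  0ₛ ⊕ ∑ₛ (- + m) (suc (double m)) (gaussTermˡʳ n) ⊕ 0ₛ     ≈⟨ (λ t → trans (ℤ.+-identityʳ _) (ℤ.+-identityˡ _)) ⟩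
  ∑ₛ (- + m) (suc (double m)) (gaussTermˡʳ n)              ≈⟨ ∑ₛ-cong (- + m) (suc (double m))
                                                                (λ k → term-cong {s = sgn k} {e = sq k} refl refl (x≡ (+ m) k) (y≡ (+ m) k)) ⟩
  gaussSum m                                               ∎
  where
  open ≈-Reasoning
  n = suc m
  lo = - + n
  L = double n
  lo+1≡ : ∀ m → - (1ℤ + m) + 1ℤ ≡ - m
  lo+1≡ = solve-∀
  x≡ : ∀ m k → 1ℤ + m + k - 1ℤ ≡ m + k
  x≡ = solve-∀
  y≡ : ∀ m k → 1ℤ + m - k - 1ℤ ≡ m - k
  y≡ = solve-∀
  bottom-vanishes : gaussTermˡʳ n lo ≈ 0ₛ
  bottom-vanishes = term-vanishesˡ (sgn lo) (sq lo) (+ n + lo - 1ℤ) (+ n - lo - 1ℤ) (lemma (+ n))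
    where
    lemma : ∀ n → n + - n - 1ℤ ≡ -1ℤ
    lemma = solve-∀
  range : lo + lo + + L ≡ -1ℤ + 1ℤ
  range = trans (cong (λ m → lo + lo + m) (+double n)) (lemma (+ n))
    where
    lemma : ∀ n → - n + - n + (n + n) ≡ -1ℤ + 1ℤ
    lemma = solve-∀

finite-gauss : ∀ n → gaussSum n ≈ Q n
finite-gauss zero = λ t → trans (ℤ.+-identityʳ _)
  (≈-trans (⊛-identityˡ (one ⊛ (one ⊛ one))) (≈-trans (⊛-identityˡ (one ⊛ one)) (⊛-identityˡ one)) t)
finite-gauss (suc m) = begin
  gaussSum n                ≈⟨ *-identityʳ (gaussSum n) ⟨
  gaussSum n ⊛ one          ≈⟨ ⊛-congˡ (gaussSum n) (geomQ-inverse (suc (suc (suc (double (double m)))))) ⟨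
  gaussSum n ⊛ (d ⊛ g)      ≈⟨ solve 3 (λ s d g → s :* (d :* g) := (d :* s) :* g) ≈-refl (gaussSum n) d g ⟩
  (d ⊛ gaussSum n) ⊛ g      ≈⟨ ⊛-congʳ g (gaussSum-telescope n) ⟩
  lowSum n ⊛ g              ≈⟨ ⊛-congʳ g (lowSum-shift m) ⟩
  gaussSum m ⊛ g            ≈⟨ ⊛-congʳ g (finite-gauss m) ⟩
  Q m ⊛ g                   ∎
  where
  open ≈-Reasoning
  n = suc m
  d = one ⊕ ⊖ q²^ double n
  g = geomQ (double (double n))

-- Truncation to Gauss's identity

P-stable : ∀ {a c} → a ≤ c → P c ≈[ suc (double a) ] P a
P-stable = ∏-stable (geomQ ∘ double) (suc ∘ double) (s≤s ∘ double-mono) (λ i → geomQ≈[]one (suc (double i)))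

-- As j² ≥ j, the factor q^{2j²} pushes the error of replacing P (n ± j) by P n beyond degree 2n + 1.
P²-shift : ∀ n j → j ≤ n → q²^ (j ℕ.* j) ⊛ (P (n ℕ.+ j) ⊛ P (n ∸ j)) ≈[ suc (double n) ] q²^ (j ℕ.* j) ⊛ (P n ⊛ P n)
P²-shift n j j≤n = ≈[]-weaken bound (q^-⊛-cong[] (double (j ℕ.* j)) P-pair)
  where
  c = n ∸ j
  P-pair : P (n ℕ.+ j) ⊛ P c ≈[ suc (double c) ] P n ⊛ P n
  P-pair = begin
    P (n ℕ.+ j) ⊛ P c  ≈⟨ ⊛-congʳ[] (P c) (P-stable (ℕ.≤-trans (ℕ.m∸n≤m n j) (ℕ.m≤m+n n j))) ⟩
    P c ⊛ P c          ≈⟨ ⊛-cong[] (P-stable (ℕ.m∸n≤m n j)) (P-stable (ℕ.m∸n≤m n j)) ⟨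
    P n ⊛ P n          ∎
    where open ≈[]-Reasoning (suc (double c))
  bound : suc (double n) ≤ double (j ℕ.* j) ℕ.+ suc (double c)
  bound = begin
    suc (double n)                        ≡⟨ cong (suc ∘ double) (ℕ.m∸n+n≡m j≤n) ⟨
    suc (double (c ℕ.+ j))                ≡⟨ cong suc (trans (double-+ c j) (ℕ.+-comm (double c) (double j))) ⟩
    suc (double j ℕ.+ double c)           ≤⟨ s≤s (ℕ.+-monoˡ-≤ (double c) (double-mono (m≤m*m j))) ⟩
    suc (double (j ℕ.* j) ℕ.+ double c)   ≡⟨ ℕ.+-suc (double (j ℕ.* j)) (double c) ⟨
    double (j ℕ.* j) ℕ.+ suc (double c)   ∎
    where
    open ℕ.≤-Reasoning
    m≤m*m : ∀ m → m ≤ m ℕ.* m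
    m≤m*m zero    = z≤n
    m≤m*m (suc m) = ℕ.m≤m*n (suc m) (suc m)

θterm : ℤ → PS
θterm k = const (sgn k) ⊛ q²^ sq k

θ : ℕ → PS
θ n = ∑ₛ (- + n) (suc (double n)) θterm

gaussTerm-by-∣k∣ : ∀ n k → ∣ k ∣ ≤ n →
                   gaussTerm n k ≈ const (sgn k) ⊛ (q²^ sq k ⊛ (P (n ℕ.+ ∣ k ∣) ⊛ P (n ∸ ∣ k ∣)))
gaussTerm-by-∣k∣ n (+ j) j≤n =
  ⊛-congˡ (const (sgn (+ j))) (⊛-congˡ (q²^ sq (+ j)) (⊛-congˡ (P (n ℕ.+ j)) (λ t → cong (λ x → Pℤ x t) n-j≡n∸j)))
  where
  n-j≡n∸j : + n - + j ≡ + (n ∸ j)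
  n-j≡n∸j = trans (ℤ.m-n≡m⊖n n j) (ℤ.⊖-≥ j≤n)
gaussTerm-by-∣k∣ n -[1+ j ] j<n =
  ⊛-congˡ (const (sgn -[1+ j ])) (⊛-congˡ (q²^ sq -[1+ j ])
    (≈-trans (⊛-congʳ (P (n ℕ.+ suc j)) (λ t → cong (λ x → Pℤ x t) (ℤ.⊖-≥ j<n)))
             (⊛-comm (P (n ∸ suc j)) (P (n ℕ.+ suc j)))))

gaussTerm-truncate : ∀ n k → ∣ k ∣ ≤ n → gaussTerm n k ≈[ suc (double n) ] θterm k ⊛ (P n ⊛ P n)
gaussTerm-truncate n k k≤n = begin
  gaussTerm n k                                                     ≈⟨ ≈⇒≈[] T (gaussTerm-by-∣k∣ n k k≤n) ⟩
  const (sgn k) ⊛ (q²^ sq k ⊛ (P (n ℕ.+ ∣ k ∣) ⊛ P (n ∸ ∣ k ∣)))   ≈⟨ ⊛-congˡ[] (const (sgn k)) (P²-shift n ∣ k ∣ k≤n) ⟩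
  const (sgn k) ⊛ (q²^ sq k ⊛ (P n ⊛ P n))                          ≈⟨ ≈⇒≈[] T (⊛-assoc (const (sgn k)) (q²^ sq k) (P n ⊛ P n)) ⟨
  θterm k ⊛ (P n ⊛ P n)                                             ∎
  where
  T = suc (double n)
  open ≈[]-Reasoning T

∣-n+i∣≤n : ∀ n i → i ≤ double n → ∣ - + n + + i ∣ ≤ n
∣-n+i∣≤n n i i≤2n with i ℕ.≤? n
... | yes i≤n = subst (_≤ n) (sym (trans (cong ∣_∣ (ℤ.-m+n≡n⊖m n i)) (ℤ.∣⊖∣-≤ i≤n))) (ℕ.m∸n≤m n i)
... | no  i≰n = subst (_≤ n) (sym (trans (cong ∣_∣ (ℤ.-m+n≡n⊖m n i)) (trans (ℤ.∣m⊖n∣≡∣n⊖m∣ i n) (ℤ.∣⊖∣-≤ (ℕ.<⇒≤ (ℕ.≰⇒> i≰n))))))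
                      (subst (i ∸ n ≤_) (ℕ.m+n∸n≡m n n) (ℕ.∸-monoˡ-≤ n (subst (i ≤_) (double≡+ n) i≤2n)))

gaussSum-truncate : ∀ n → gaussSum n ≈[ suc (double n) ] θ n ⊛ (P n ⊛ P n)
gaussSum-truncate n = begin
  ∑ₛ (- + n) (suc (double n)) (gaussTerm n)
    ≈⟨ ∑ₛ-cong[] (- + n) (suc (double n)) {gaussTerm n} {λ k → θterm k ⊛ (P n ⊛ P n)} (λ i i≤2n → gaussTerm-truncate n (- + n + + i) (∣-n+i∣≤n n i (ℕ.≤-pred i≤2n))) ⟩
  ∑ₛ (- + n) (suc (double n)) (λ k → θterm k ⊛ (P n ⊛ P n))
    ≈⟨ ≈⇒≈[] T (∑ₛ-⊛ (P n ⊛ P n) (- + n) (suc (double n)) θterm) ⟨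
  θ n ⊛ (P n ⊛ P n) ∎
  where
  T = suc (double n)
  open ≈[]-Reasoning T

poch₂ negPoch₂ poch₄ : ℕ → PS
poch₂    = ∏ (λ i → one ⊕ ⊖ q²^ i)
negPoch₂ = ∏ (onePlusQ ∘ double)
poch₄    = ∏ (λ i → one ⊕ ⊖ q²^ double i)

evenFactors : ℕ → PS
evenFactors = ∏ (factor ∘ double)

poch₂-⊛-P : ∀ a → poch₂ a ⊛ P a ≈ one
poch₂-⊛-P a = ≈-trans (∏-⊛ _ (geomQ ∘ double) a) (∏-one (λ i → geomQ-inverse (suc (double i))) a)

poch₄-⊛-Q : ∀ a → poch₄ a ⊛ Q a ≈ one
poch₄-⊛-Q a = ≈-trans (∏-⊛ _ (geomQ ∘ double ∘ double) a)
                      (∏-one (λ i → geomQ-inverse (suc (suc (suc (double (double i)))))) a)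

poch₂-⊛-negPoch₂ : ∀ a → poch₂ a ⊛ negPoch₂ a ≈ poch₄ a
poch₂-⊛-negPoch₂ a = ≈-trans (∏-⊛ _ (onePlusQ ∘ double) a) (∏-cong difference-of-squares a)
  where
  difference-of-squares : ∀ i → (one ⊕ ⊖ q²^ suc i) ⊛ onePlusQ (double (suc i)) ≈ one ⊕ ⊖ q²^ double (suc i)
  difference-of-squares i = begin
    (one ⊕ ⊖ x) ⊛ onePlusQ (double (suc i))   ≈⟨ ⊛-congˡ (one ⊕ ⊖ x) (onePlusQ≈ (suc (double i))) ⟩
    (one ⊕ ⊖ x) ⊛ (one ⊕ x)                   ≈⟨ solve 1 (λ x → (con 1ℤ :- x) :* (con 1ℤ :+ x) := con 1ℤ :- x :* x) ≈-refl x ⟩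
    one ⊕ ⊖ (x ⊛ x)                           ≈⟨ +-congˡ {one} (λ t → cong -_ (trans (q²^-+ (suc i) (suc i) t)
                                                   (cong (λ e → (q²^ e) t) (sym (double≡+ (suc i)))))) ⟩
    one ⊕ ⊖ q²^ double (suc i)                ∎
    where
    open ≈-Reasoning
    x = q²^ suc i

evenFactors≈negPoch₂⊛P : ∀ a → evenFactors a ≈ negPoch₂ a ⊛ P a
evenFactors≈negPoch₂⊛P a = ≈-sym (∏-⊛ (onePlusQ ∘ double) (geomQ ∘ double) a)

θ-⊛-evenFactors : ∀ n → θ n ⊛ evenFactors n ≈[ suc (double n) ] one
θ-⊛-evenFactors n = begin
  θ n ⊛ evenFactors n                                 ≈⟨ ≈⇒≈[] T (⊛-congˡ (θ n) (evenFactors≈negPoch₂⊛P n)) ⟩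
  θ n ⊛ (negPoch₂ n ⊛ P n)                            ≈⟨ ≈⇒≈[] T (*-identityʳ (θ n ⊛ (negPoch₂ n ⊛ P n))) ⟨
  (θ n ⊛ (negPoch₂ n ⊛ P n)) ⊛ one                    ≈⟨ ≈⇒≈[] T (⊛-congˡ (θ n ⊛ (negPoch₂ n ⊛ P n)) (poch₂-⊛-P n)) ⟨
  (θ n ⊛ (negPoch₂ n ⊛ P n)) ⊛ (poch₂ n ⊛ P n)        ≈⟨ ≈⇒≈[] T (solve 4 (λ θ v p u → (θ :* (v :* p)) :* (u :* p) := (θ :* (p :* p)) :* (u :* v))
                                                                     ≈-refl (θ n) (negPoch₂ n) (P n) (poch₂ n)) ⟩
  (θ n ⊛ (P n ⊛ P n)) ⊛ (poch₂ n ⊛ negPoch₂ n)        ≈⟨ ⊛-cong[] (gaussSum-truncate n) (≈⇒≈[] T (≈-sym (poch₂-⊛-negPoch₂ n))) ⟨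
  gaussSum n ⊛ poch₄ n                                ≈⟨ ≈⇒≈[] T (⊛-congʳ (poch₄ n) (finite-gauss n)) ⟩
  Q n ⊛ poch₄ n                                       ≈⟨ ≈⇒≈[] T (≈-trans (⊛-comm (Q n) (poch₄ n)) (poch₄-⊛-Q n)) ⟩
  one                                                 ∎
  where
  T = suc (double n)
  open ≈[]-Reasoning T

-- Overpartitions

selected : (ℕ → Bool) → (ℕ → PS) → ℕ → PS
selected sel g k = if sel k then g k else one

prodFactors≈∏ : ∀ sel N → prodFactors sel N ≈ ∏ (selected sel factor) N
prodFactors≈∏ sel zero    = ≈-refl
prodFactors≈∏ sel (suc N) with sel (suc N)
... | true  = ⊛-congʳ (factor (suc N)) (prodFactors≈∏ sel N)
... | false = ≈-trans (prodFactors≈∏ sel N) (≈-sym (*-identityʳ (∏ (selected sel factor) N)))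

selected-complement : ∀ sel g k → selected sel g k ⊛ selected (not ∘ sel) g k ≈ g k
selected-complement sel g k with sel k
... | true  = *-identityʳ (g k)
... | false = ⊛-identityˡ (g k)

selected-factor≈[]one : ∀ sel k → selected sel factor (suc k) ≈[ k ] one
selected-factor≈[]one sel k with sel (suc k)
... | true  = factor≈[]one k
... | false = λ _ _ → refl

isEven : ℕ → Bool
isEven = not ∘ isOdd

isOdd-double : ∀ j → isOdd (double j) ≡ false
isOdd-double zero    = refl
isOdd-double (suc j) = isOdd-double j

isOdd-suc-double : ∀ j → isOdd (suc (double j)) ≡ true
isOdd-suc-double zero    = refl
isOdd-suc-double (suc j) = isOdd-suc-double j

∏-evens : ∀ g → (∀ j → g (suc (double j)) ≈ one) → ∀ j → ∏ g (suc (double j)) ≈ ∏ (g ∘ double) j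
∏-evens g g-odd≈1 zero    = ≈-trans (⊛-identityˡ (g 1)) (g-odd≈1 0)
∏-evens g g-odd≈1 (suc j) = begin
  (∏ g (suc (double j)) ⊛ g (double (suc j))) ⊛ g (suc (double (suc j)))
    ≈⟨ ⊛-congˡ (∏ g (suc (double j)) ⊛ g (double (suc j))) (g-odd≈1 (suc j)) ⟩
  (∏ g (suc (double j)) ⊛ g (double (suc j))) ⊛ one
    ≈⟨ *-identityʳ (∏ g (suc (double j)) ⊛ g (double (suc j))) ⟩
  ∏ g (suc (double j)) ⊛ g (double (suc j))
    ≈⟨ ⊛-congʳ (g (double (suc j))) (∏-evens g g-odd≈1 j) ⟩
  ∏ (g ∘ double) j ⊛ g (double (suc j)) ∎
  where open ≈-Reasoning

evenPart≈evenFactors : ∀ j → prodFactors isEven (suc (double j)) ≈ evenFactors j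
evenPart≈evenFactors j = ≈-trans (prodFactors≈∏ isEven (suc (double j)))
                          (≈-trans (∏-evens (selected isEven factor) odd≈1 j) (∏-cong even≈factor j))
  where
  odd≈1 : ∀ j → selected isEven factor (suc (double j)) ≈ one
  odd≈1 j rewrite isOdd-suc-double j = ≈-refl
  even≈factor : ∀ i → selected isEven factor (double (suc i)) ≈ factor (double (suc i))
  even≈factor i rewrite isOdd-double i = ≈-refl

prodFactors-stable : ∀ sel {N N′} → N ≤ N′ → prodFactors sel N′ ≈[ N ] prodFactors sel N
prodFactors-stable sel {N} {N′} N≤N′ t t≤N = begin
  prodFactors sel N′ t                ≡⟨ prodFactors≈∏ sel N′ t ⟩
  ∏ (selected sel factor) N′ t        ≡⟨ ∏-stable (selected sel factor) (λ k → k) (λ i≤j → i≤j) (selected-factor≈[]one sel) N≤N′ t t≤N ⟩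
  ∏ (selected sel factor) N t         ≡⟨ prodFactors≈∏ sel N t ⟨
  prodFactors sel N t                 ∎
  where open ≡-Reasoning

prodFactors-split : ∀ N → prodFactors (λ _ → true) N ≈ prodFactors isOdd N ⊛ prodFactors isEven N
prodFactors-split N = begin
  prodFactors (λ _ → true) N                                        ≈⟨ prodFactors≈∏ (λ _ → true) N ⟩
  ∏ factor N                                                        ≈⟨ ∏-cong (λ k → selected-complement isOdd factor (suc k)) N ⟨
  ∏ (λ k → selected isOdd factor k ⊛ selected isEven factor k) N    ≈⟨ ∏-⊛ (selected isOdd factor) (selected isEven factor) N ⟨
  ∏ (selected isOdd factor) N ⊛ ∏ (selected isEven factor) N        ≈⟨ ⊛-cong (prodFactors≈∏ isOdd N) (prodFactors≈∏ isEven N) ⟨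
  prodFactors isOdd N ⊛ prodFactors isEven N                        ∎
  where open ≈-Reasoning

θ-⊛-evenPart : ∀ {n M} → n ≤ M → θ M ⊛ prodFactors isEven n ≈[ n ] one
θ-⊛-evenPart {n} {M} n≤M = begin
  θ M ⊛ prodFactors isEven n                   ≈⟨ ⊛-congˡ[] (θ M) (prodFactors-stable isEven n≤2M+1) ⟨
  θ M ⊛ prodFactors isEven (suc (double M))    ≈⟨ ≈⇒≈[] n (⊛-congˡ (θ M) (evenPart≈evenFactors M)) ⟩
  θ M ⊛ evenFactors M                          ≈⟨ ≈[]-weaken n≤2M+1 (θ-⊛-evenFactors M) ⟩
  one                                          ∎
  where
  open ≈[]-Reasoning n
  n≤2M+1 : n ≤ suc (double M)
  n≤2M+1 = ℕ.≤-trans n≤M (ℕ.≤-trans (ℕ.m≤m+n M M) (ℕ.≤-trans (ℕ.≤-reflexive (sym (double≡+ M))) (ℕ.n≤1+n _)))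

pbarℤ-shift : ∀ d N → pbarℤ (+ N - + d) ≡ (q^ d ⊛ prodFactors (λ _ → true) N) N
pbarℤ-shift d = split-at d below above
  where
  all = λ (_ : ℕ) → true
  below : ∀ N → N < d → pbarℤ (+ N - + d) ≡ (q^ d ⊛ prodFactors all N) N
  below N N<d = begin
    pbarℤ (+ N - + d)                  ≡⟨ cong pbarℤ (trans (ℤ.m-n≡m⊖n N d) (trans (ℤ.⊖-< N<d) (cong (λ m → - + m) (ℕ.+-∸-assoc 1 N<d)))) ⟩
    pbarℤ -[1+ d ∸ suc N ]             ≡⟨ q^-⊛-below d (prodFactors all N) N N<d ⟨
    (q^ d ⊛ prodFactors all N) N       ∎
    where open ≡-Reasoning
  above : ∀ m → pbarℤ (+ (d ℕ.+ m) - + d) ≡ (q^ d ⊛ prodFactors all (d ℕ.+ m)) (d ℕ.+ m)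
  above m = begin
    pbarℤ (+ (d ℕ.+ m) - + d)                      ≡⟨ cong pbarℤ (trans (ℤ.m-n≡m⊖n (d ℕ.+ m) d)
                                                       (trans (ℤ.⊖-≥ (ℕ.m≤m+n d m)) (cong +_ (ℕ.m+n∸m≡n d m)))) ⟩
    prodFactors all m m                            ≡⟨ prodFactors-stable all (ℕ.m≤n+m m d) m ℕ.≤-refl ⟨
    prodFactors all (d ℕ.+ m) m                    ≡⟨ q^-⊛-above d (prodFactors all (d ℕ.+ m)) m ⟨
    (q^ d ⊛ prodFactors all (d ℕ.+ m)) (d ℕ.+ m)   ∎
    where open ≡-Reasoning

summand-as-coeff : ∀ n k → summand n k ≡ (θterm k ⊛ prodFactors (λ _ → true) n) n
summand-as-coeff n k = begin
  sgn k * pbarℤ (+ n - + 2 * (k * k))            ≡⟨ cong (λ m → sgn k * pbarℤ (+ n - m)) 2k²≡ ⟩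
  sgn k * pbarℤ (+ n - + double (sq k))          ≡⟨ cong (sgn k *_) (pbarℤ-shift (double (sq k)) n) ⟩
  sgn k * (q²^ sq k ⊛ A) n                       ≡⟨ const-⊛ (sgn k) (q²^ sq k ⊛ A) n ⟨
  (const (sgn k) ⊛ (q²^ sq k ⊛ A)) n             ≡⟨ ⊛-assoc (const (sgn k)) (q²^ sq k) A n ⟨
  (θterm k ⊛ A) n                                ∎
  where
  open ≡-Reasoning
  A = prodFactors (λ _ → true) n
  2k²≡ : + 2 * (k * k) ≡ + double (sq k)
  2k²≡ = trans (lemma (k * k)) (sym (trans (+double (sq k)) (cong₂ _+_ (+sq k) (+sq k))))
    where
    lemma : ∀ x → + 2 * x ≡ x + x
    lemma = solve-∀

sum-map-applyUpTo : ∀ (f : ℕ → ℤ) g n → sumℤ (map f (applyUpTo g n)) ≡ ∑< n (f ∘ g)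
sum-map-applyUpTo f g zero    = refl
sum-map-applyUpTo f g (suc n) = cong (_+_ (f (g 0))) (sum-map-applyUpTo f (g ∘ suc) n)

symSum-summand : ∀ n M → symSum M (summand n) ≡ (θ M ⊛ prodFactors (λ _ → true) n) n
symSum-summand n M = begin
  symSum M (summand n)                                      ≡⟨ sum-map-applyUpTo (λ i → summand n (+ i - + M)) (λ i → i) (suc (2 ℕ.* M)) ⟩
  ∑[ i < suc (2 ℕ.* M) ] summand n (+ i - + M)              ≡⟨ cong (λ L → ∑[ i < suc L ] summand n (+ i - + M)) 2M≡ ⟩
  ∑[ i < suc (double M) ] summand n (+ i - + M)             ≡⟨ ∑-cong (suc (double M)) (λ i _ →
                                                                 trans (cong (summand n) (ℤ.+-comm (+ i) (- + M))) (summand-as-coeff n (- + M + + i))) ⟩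
  ∑ₛ (- + M) (suc (double M)) (λ k → θterm k ⊛ A) n         ≡⟨ ∑ₛ-⊛ A (- + M) (suc (double M)) θterm n ⟨
  (θ M ⊛ A) n                                               ∎
  where
  open ≡-Reasoning
  A = prodFactors (λ _ → true) n
  2M≡ : 2 ℕ.* M ≡ double M
  2M≡ = trans (cong (M ℕ.+_) (ℕ.+-identityʳ M)) (sym (double≡+ M))

theorem3p5 : (n M : ℕ) → n ≤ M → symSum M (summand n) ≡ pbaro n
theorem3p5 n M n≤M = begin
  symSum M (summand n)                                          ≡⟨ symSum-summand n M ⟩
  (θ M ⊛ prodFactors (λ _ → true) n) n                          ≡⟨ ⊛-congˡ (θ M) (prodFactors-split n) n ⟩
  (θ M ⊛ (prodFactors isOdd n ⊛ prodFactors isEven n)) n        ≡⟨ solve 3 (λ θ o e → θ :* (o :* e) := o :* (θ :* e)) ≈-refl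
                                                                     (θ M) (prodFactors isOdd n) (prodFactors isEven n) n ⟩
  (prodFactors isOdd n ⊛ (θ M ⊛ prodFactors isEven n)) n        ≡⟨ ⊛-congˡ[] (prodFactors isOdd n) (θ-⊛-evenPart n≤M) n ℕ.≤-refl ⟩
  (prodFactors isOdd n ⊛ one) n                                 ≡⟨ *-identityʳ (prodFactors isOdd n) n ⟩
  pbaro n                                                       ∎
  where open ≡-Reasoning
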